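{- Let $n\ge 1$, let $\sigma$ be a permutation of $[n]$ and $\overline{\sigma}$ its reverse. Then the distance between the linear extensions $L_\sigma$ and $L_{\overline{\sigma}}$ of the Boolean lattice $B_n$ equals $2^{2n-2}-(n+1)\cdot 2^{n-2}$.
   Context: $B_n$ is the poset of all subsets of $[n]$ ordered by inclusion. For a permutation $\sigma$ of $[n]$, $i<_\sigma j$ means $\sigma^{ -1}(i)<\sigma^{ -1}(j)$, and $\max_\sigma S$ is the $\sigma$-largest element of $S$. $L_\sigma$ is the linear extension of $B_n$ given by $S<T$ iff $\max_\sigma(S\triangle T)\in T$ (the $\sigma$-revlex order). The reverse $\overline{\sigma}$ of $\sigma$ is the permutation listing $[n]$ in the opposite order. The distance between two linear extensions of a poset is the number of unordered pairs of elements that appear in different orders in them. -}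

module Defs where

open import Data.Nat using (ℕ; zero; suc; _<ᵇ_)
open import Data.Bool using (Bool; true; false; _∧_; if_then_else_; _xor_)
open import Data.Fin using (Fin; toℕ)
open import Data.Fin.Subset using (Subset; Side; inside; outside)
open import Data.Fin.Permutation using (Permutation′; _⟨$⟩ʳ_; _⟨$⟩ˡ_; _∘ₚ_; reverse)
open import Data.List using (List; []; _∷_; filter; length; map; concatMap; allFin)
open import Data.Vec using (Vec; lookup; _∷_; [])
open import Data.Maybe using (Maybe; just; nothing)
open import Relation.Nullary.Decidable using (Dec)
open import Relation.Binary.PropositionalEquality using (_≡_)
open import Data.Bool.Properties using (T?)
open import Data.Bool using (T)

-- A permutation σ of [n] = {0,…,n-1} (0-indexed), read as the list
-- σ(0), σ(1), …, σ(n-1): position k ↦ element σ ⟨$⟩ʳ k.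
-- Hence σ⁻¹(i) = σ ⟨$⟩ˡ i is the position of element i.

_<[_]_ : ∀ {n} → Fin n → Permutation′ n → Fin n → Bool
i <[ σ ] j = toℕ (σ ⟨$⟩ˡ i) <ᵇ toℕ (σ ⟨$⟩ˡ j)

-- reverse of σ: lists [n] in the opposite order, σ̄(k) = σ(n-1-k)
rev : ∀ {n} → Permutation′ n → Permutation′ n
rev σ = reverse ∘ₚ σ

_∈ᵇ_ : ∀ {n} → Fin n → Subset n → Bool
i ∈ᵇ S with lookup S i
... | inside  = true
... | outside = false

symDiff : ∀ {n} → Subset n → Subset n → List (Fin n)
symDiff S T = filter (λ i → T? ((i ∈ᵇ S) xor (i ∈ᵇ T))) (allFin _)

maxσ : ∀ {n} → Permutation′ n → List (Fin n) → Maybe (Fin n)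
maxσ σ [] = nothing
maxσ σ (x ∷ xs) with maxσ σ xs
... | nothing = just x
... | just y  = if x <[ σ ] y then just y else just x

-- The σ-revlex linear extension L_σ of B_n:
-- S < T  iff  max_σ (S △ T) ∈ T   (false when S = T)
Lt : ∀ {n} → Permutation′ n → Subset n → Subset n → Bool
Lt σ S T with maxσ σ (symDiff S T)
... | nothing = false
... | just x  = x ∈ᵇ T

allSubsets : (n : ℕ) → List (Subset n)
allSubsets zero    = [] ∷ []
allSubsets (suc n) = concatMap (λ S → (inside ∷ S) ∷ (outside ∷ S) ∷ []) (allSubsets n)


-- Distance between L_σ and L_τ: number of unordered pairs {S,T} ordered
-- differently; each such pair is counted once as the ordered pair (S,T)
-- with S <_σ T and T <_τ S.
distance : ∀ {n} → Permutation′ n → Permutation′ n → ℕ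
distance {n} σ τ =
  length (filter (λ b → T? b)
    (concatMap (λ S → map (λ T → Lt σ S T ∧ Lt τ T S) (allSubsets n)) (allSubsets n)))

-- Relabel every subset through σ, reading S as the bit vector k ↦ [σ(k) ∈ S]. Then L_σ becomes
-- the colex order of bit vectors (the last differing position decides) and L_σ̄ the lex order
-- (the first differing position decides), so the distance counts the pairs u, v with u <colex v
-- and v <lex u. Splitting off the first bit gives W(n+1) = 2 W(n) + C(n), where
-- C(n) = (4ⁿ − 2ⁿ)/2 counts the colex-ordered pairs; hence 4 W(n) = 4ⁿ − (n+1) 2ⁿ.
module Submission where

open import Defs
open import Data.Nat using (ℕ; zero; suc; _+_; _*_; _^_; _≤_; z<s; s<s) renaming (_<_ to _<ℕ_)
import Data.Nat.Properties as ℕ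
open import Data.Nat.ListAction using (sum)
open import Data.Nat.ListAction.Properties using (sum-↭)
open import Data.Nat.Tactic.RingSolver using (solve-∀)
open import Algebra.Properties.CommutativeSemigroup ℕ.+-commutativeSemigroup using (interchange)
open import Data.Bool using (Bool; true; false; T; not; _∧_; _∨_; _xor_; if_then_else_)
open import Data.Bool.Properties using (T?; T-≡; ⇔→≡; ∧-identityʳ; ∧-zeroʳ) renaming (_≟_ to _≟ᵇ_)
open import Data.Empty using (⊥-elim)
open import Data.Fin using (Fin; zero; suc; toℕ; _<_; _>_; opposite)
open import Data.Fin.Properties using (opposite-prop; opposite-involutive; toℕ<n; <-cmp; <-asym; <-irrefl)
open import Data.Fin.Permutation using (Permutation′; _⟨$⟩ʳ_; _⟨$⟩ˡ_; inverseˡ; inverseʳ; flip)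
open import Data.Fin.Subset using (Subset)
open import Data.List using (List; []; _∷_; _++_; map; filter; length; concatMap; allFin)
open import Data.List.Properties using (map-cong; map-∘; filter-++; length-++)
open import Data.List.Membership.Propositional using (_∈_)
open import Data.List.Membership.Propositional.Properties using (∈-map⁺; ∈-filter⁺; ∈-filter⁻; ∈-allFin)
open import Data.List.Membership.Propositional.Properties.WithK using (unique∧set⇒bag)
open import Data.List.Relation.Unary.Any using (here; there)
open import Data.List.Relation.Unary.All using (All; []; _∷_)
open import Data.List.Relation.Unary.AllPairs using ([]; _∷_)
open import Data.List.Relation.Unary.Unique.Propositional using (Unique)
import Data.List.Relation.Unary.Unique.Propositional.Properties as Unique
open import Data.List.Relation.Binary.BagAndSetEquality using (∼bag⇒↭)
open import Data.List.Relation.Binary.Permutation.Propositional using (_↭_)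
open import Data.List.Relation.Binary.Permutation.Propositional.Properties using (map⁺)
open import Data.Maybe using (Maybe; just; nothing)
open import Data.Product using (_×_; _,_; ∃; proj₂)
open import Data.Vec using (_∷_; []; lookup; tabulate; tail)
open import Data.Vec.Properties using (lookup∘tabulate; tabulate∘lookup; tabulate-cong)
open import Function using (_∘_; _⇔_; mk⇔; Equivalence)
import Function.Properties.Equivalence as ⇔
open import Relation.Binary.Definitions using (tri<; tri≈; tri>)
open import Relation.Nullary using (¬_; yes; no)
open import Relation.Binary.PropositionalEquality

private
  variable
    n : ℕ

indicator : Bool → ℕ
indicator b = if b then 1 else 0

∑ : (Subset n → ℕ) → ℕ
∑ f = sum (map f (allSubsets _))

#pairs : (Subset n → Subset n → Bool) → ℕ
#pairs P = ∑ λ u → ∑ λ v → indicator (P u v)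

sum-map-+ : ∀ {A : Set} (f g : A → ℕ) (xs : List A) →
  sum (map (λ x → f x + g x) xs) ≡ sum (map f xs) + sum (map g xs)
sum-map-+ f g [] = refl
sum-map-+ f g (x ∷ xs) =
  trans (cong (f x + g x +_) (sum-map-+ f g xs)) (interchange (f x) (g x) _ _)

sum-map-zero : ∀ {A : Set} (xs : List A) → sum (map (λ _ → 0) xs) ≡ 0
sum-map-zero [] = refl
sum-map-zero (x ∷ xs) = sum-map-zero xs

length-filter-T?-map : ∀ {A : Set} (h : A → Bool) (xs : List A) →
  length (filter T? (map h xs)) ≡ sum (map (indicator ∘ h) xs)
length-filter-T?-map h [] = refl
length-filter-T?-map h (x ∷ xs) with h x
... | true  = cong suc (length-filter-T?-map h xs)
... | false = length-filter-T?-map h xs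

length-filter-T?-concatMap : ∀ {A : Set} (g : A → List Bool) (xs : List A) →
  length (filter T? (concatMap g xs)) ≡ sum (map (λ x → length (filter T? (g x))) xs)
length-filter-T?-concatMap g [] = refl
length-filter-T?-concatMap g (x ∷ xs) = begin
  length (filter T? (g x ++ concatMap g xs))
    ≡⟨ cong length (filter-++ T? (g x) _) ⟩
  length (filter T? (g x) ++ filter T? (concatMap g xs))
    ≡⟨ length-++ (filter T? (g x)) ⟩
  length (filter T? (g x)) + length (filter T? (concatMap g xs))
    ≡⟨ cong (length (filter T? (g x)) +_) (length-filter-T?-concatMap g xs) ⟩
  length (filter T? (g x)) + sum (map (λ x → length (filter T? (g x))) xs) ∎
  where open ≡-Reasoning

∑-cong : {f g : Subset n → ℕ} → (∀ u → f u ≡ g u) → ∑ f ≡ ∑ g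
∑-cong {n} f≗g = cong sum (map-cong f≗g (allSubsets n))

∑-suc : (f : Subset (suc n) → ℕ) → ∑ f ≡ ∑ (λ u → f (true ∷ u) + f (false ∷ u))
∑-suc {n} f = go (allSubsets n)
  where
  go : (us : List (Subset n)) →
    sum (map f (concatMap (λ u → (true ∷ u) ∷ (false ∷ u) ∷ []) us))
      ≡ sum (map (λ u → f (true ∷ u) + f (false ∷ u)) us)
  go [] = refl
  go (u ∷ us) = trans (sym (ℕ.+-assoc (f (true ∷ u)) _ _)) (cong (_ +_) (go us))

∈-allSubsets : (u : Subset n) → u ∈ allSubsets n
∈-allSubsets [] = here refl
∈-allSubsets {suc n} (b ∷ u) = step b (allSubsets n) (∈-allSubsets u)
  where
  step : ∀ b {u} (us : List (Subset n)) → u ∈ us →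
    (b ∷ u) ∈ concatMap (λ u → (true ∷ u) ∷ (false ∷ u) ∷ []) us
  step true  (_ ∷ _)  (here refl) = here refl
  step false (_ ∷ _)  (here refl) = there (here refl)
  step b     (_ ∷ us) (there p)   = there (there (step b us p))

allSubsets-unique : ∀ n → Unique (allSubsets n)
allSubsets-unique zero = [] ∷ []
allSubsets-unique (suc n) = step (allSubsets n) (allSubsets-unique n)
  where
  extend : List (Subset n) → List (Subset (suc n))
  extend = concatMap (λ u → (true ∷ u) ∷ (false ∷ u) ∷ [])

  fresh : ∀ b {u} (us : List (Subset n)) → All (u ≢_) us → All ((b ∷ u) ≢_) (extend us)
  fresh b [] [] = []
  fresh b (_ ∷ us) (u≢ ∷ u∉) = (u≢ ∘ cong tail) ∷ (u≢ ∘ cong tail) ∷ fresh b us u∉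

  step : (us : List (Subset n)) → Unique us → Unique (extend us)
  step [] [] = []
  step (u ∷ us) (u∉ ∷ uniq) = ((λ ()) ∷ fresh true us u∉) ∷ fresh false us u∉ ∷ step us uniq

relabel : Permutation′ n → Subset n → Subset n
relabel π u = tabulate (λ k → lookup u (π ⟨$⟩ʳ k))

lookup-relabel : (π : Permutation′ n) (u : Subset n) (k : Fin n) →
  lookup (relabel π u) k ≡ lookup u (π ⟨$⟩ʳ k)
lookup-relabel π u = lookup∘tabulate _

relabel-cancel : (π ρ : Permutation′ n) → (∀ k → ρ ⟨$⟩ʳ (π ⟨$⟩ʳ k) ≡ k) →
  (u : Subset n) → relabel π (relabel ρ u) ≡ u
relabel-cancel π ρ ρπ≗id u = begin
  tabulate (λ k → lookup (relabel ρ u) (π ⟨$⟩ʳ k)) ≡⟨ tabulate-cong (λ k → lookup-relabel ρ u (π ⟨$⟩ʳ k)) ⟩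
  tabulate (λ k → lookup u (ρ ⟨$⟩ʳ (π ⟨$⟩ʳ k)))   ≡⟨ tabulate-cong (cong (lookup u) ∘ ρπ≗id) ⟩
  tabulate (lookup u)                              ≡⟨ tabulate∘lookup u ⟩
  u                                                ∎
  where open ≡-Reasoning

map-relabel-allSubsets : (π : Permutation′ n) → map (relabel π) (allSubsets n) ↭ allSubsets n
map-relabel-allSubsets {n} π = ∼bag⇒↭ (unique∧set⇒bag
  (Unique.map⁺ relabel-injective (allSubsets-unique n))
  (allSubsets-unique n)
  (λ {u} → mk⇔ (λ _ → ∈-allSubsets u) (λ _ → subst (_∈ map (relabel π) (allSubsets n))
    (relabel-cancel π (flip π) (λ _ → inverseˡ π) u) (∈-map⁺ (relabel π) (∈-allSubsets (relabel (flip π) u))))))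
  where
  relabel-injective : ∀ {u v} → relabel π u ≡ relabel π v → u ≡ v
  relabel-injective {u} {v} eq = begin
    u                                ≡⟨ relabel-cancel (flip π) π (λ _ → inverseʳ π) u ⟨
    relabel (flip π) (relabel π u)   ≡⟨ cong (relabel (flip π)) eq ⟩
    relabel (flip π) (relabel π v)   ≡⟨ relabel-cancel (flip π) π (λ _ → inverseʳ π) v ⟩
    v                                ∎
    where open ≡-Reasoning

∑-relabel : (π : Permutation′ n) (f : Subset n → ℕ) → ∑ (f ∘ relabel π) ≡ ∑ f
∑-relabel {n} π f = trans (cong sum (map-∘ (allSubsets n))) (sum-↭ (map⁺ f (map-relabel-allSubsets π)))

#pairs-cong : {P Q : Subset n → Subset n → Bool} → (∀ u v → P u v ≡ Q u v) → #pairs P ≡ #pairs Q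
#pairs-cong P≗Q = ∑-cong λ u → ∑-cong λ v → cong indicator (P≗Q u v)

#pairs-split : {P Q R : Subset n → Subset n → Bool} →
  (∀ u v → indicator (P u v) ≡ indicator (Q u v) + indicator (R u v)) →
  #pairs P ≡ #pairs Q + #pairs R
#pairs-split {n} {P} {Q} {R} P≡Q+R = begin
  ∑ (λ u → ∑ λ v → indicator (P u v))
    ≡⟨ ∑-cong (λ u → trans (∑-cong (P≡Q+R u)) (sum-map-+ _ _ (allSubsets n))) ⟩
  ∑ (λ u → (∑ λ v → indicator (Q u v)) + (∑ λ v → indicator (R u v)))
    ≡⟨ sum-map-+ _ _ (allSubsets n) ⟩
  #pairs Q + #pairs R ∎
  where open ≡-Reasoning

#pairs-false : #pairs {n} (λ _ _ → false) ≡ 0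
#pairs-false {n} = trans (∑-cong {n} λ _ → sum-map-zero (allSubsets n)) (sum-map-zero (allSubsets n))

#pairs-suc : (P : Subset (suc n) → Subset (suc n) → Bool) →
  #pairs P ≡ (#pairs (λ u v → P (true ∷ u) (true ∷ v)) + #pairs (λ u v → P (true ∷ u) (false ∷ v)))
           + (#pairs (λ u v → P (false ∷ u) (true ∷ v)) + #pairs (λ u v → P (false ∷ u) (false ∷ v)))
#pairs-suc {n} P = begin
  #pairs P
    ≡⟨ ∑-suc {n} _ ⟩
  ∑ (λ u → ∑ (λ v → indicator (P (true ∷ u) v)) + ∑ (λ v → indicator (P (false ∷ u) v)))
    ≡⟨ ∑-cong (λ u → cong₂ _+_ (split (true ∷ u)) (split (false ∷ u))) ⟩
  ∑ (λ u → (∑ (λ v → indicator (P (true ∷ u) (true ∷ v))) + ∑ (λ v → indicator (P (true ∷ u) (false ∷ v))))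
         + (∑ (λ v → indicator (P (false ∷ u) (true ∷ v))) + ∑ (λ v → indicator (P (false ∷ u) (false ∷ v)))))
    ≡⟨ trans (sum-map-+ _ _ (allSubsets n)) (cong₂ _+_ (sum-map-+ _ _ (allSubsets n)) (sum-map-+ _ _ (allSubsets n))) ⟩
  _ ∎
  where
  open ≡-Reasoning
  split : ∀ u → ∑ (λ v → indicator (P u v))
              ≡ ∑ (λ v → indicator (P u (true ∷ v))) + ∑ (λ v → indicator (P u (false ∷ v)))
  split u = trans (∑-suc {n} _) (sum-map-+ _ _ (allSubsets n))

#pairs-relabel : (π : Permutation′ n) (P : Subset n → Subset n → Bool) →
  #pairs (λ u v → P (relabel π u) (relabel π v)) ≡ #pairs P
#pairs-relabel π P = trans (∑-cong λ u → ∑-relabel π (λ v → indicator (P (relabel π u) v)))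
                           (∑-relabel π (λ u → ∑ λ v → indicator (P u v)))

distance≡#pairs : (σ τ : Permutation′ n) → distance σ τ ≡ #pairs (λ S U → Lt σ S U ∧ Lt τ U S)
distance≡#pairs {n} σ τ = trans (length-filter-T?-concatMap _ (allSubsets n))
  (∑-cong {n} λ S → length-filter-T?-map (λ U → Lt σ S U ∧ Lt τ U S) (allSubsets n))

LastDiff : (Fin n → Fin n → Set) → Subset n → Subset n → Fin n → Set
LastDiff _≺_ S U x = lookup S x ≢ lookup U x × (∀ y → x ≺ y → lookup S y ≡ lookup U y)

RevlexLt : (Fin n → Fin n → Set) → Subset n → Subset n → Set
RevlexLt _≺_ S U = ∃ λ x → LastDiff _≺_ S U x × lookup U x ≡ true

RevlexLt-cong : {_≺_ _≺′_ : Fin n → Fin n → Set} → (∀ x y → x ≺ y ⇔ x ≺′ y) →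
  {S U : Subset n} → RevlexLt _≺_ S U ⇔ RevlexLt _≺′_ S U
RevlexLt-cong ≺⇔≺′ = mk⇔
  (λ (x , (Sx≢Ux , agree) , Ux) → x , (Sx≢Ux , λ y → agree y ∘ Equivalence.from (≺⇔≺′ x y)) , Ux)
  (λ (x , (Sx≢Ux , agree) , Ux) → x , (Sx≢Ux , λ y → agree y ∘ Equivalence.to (≺⇔≺′ x y)) , Ux)

RevlexLt-relabel : (π : Permutation′ n) (_≺_ : Fin n → Fin n → Set) {S U : Subset n} →
  RevlexLt _≺_ (relabel π S) (relabel π U) ⇔ RevlexLt (λ x y → (π ⟨$⟩ˡ x) ≺ (π ⟨$⟩ˡ y)) S U
RevlexLt-relabel π _≺_ {S} {U} = mk⇔
  (λ (k , (Sπk≢Uπk , agree) , Uπk) → π ⟨$⟩ʳ k ,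
     ( (Sπk≢Uπk ∘ relabel-agree k)
     , (λ y k≺y → relabel-agree⁻¹ y (agree (π ⟨$⟩ˡ y) (subst (_≺ (π ⟨$⟩ˡ y)) (inverseˡ π) k≺y))))
     , trans (sym (lookup-relabel π U k)) Uπk)
  (λ (x , (Sx≢Ux , agree) , Ux) → π ⟨$⟩ˡ x ,
     ( (Sx≢Ux ∘ relabel-agree⁻¹ x)
     , (λ j x≺j → relabel-agree j (agree (π ⟨$⟩ʳ j) (subst ((π ⟨$⟩ˡ x) ≺_) (sym (inverseˡ π)) x≺j))))
     , trans (lookup-relabel-inverse U x) Ux)
  where
  lookup-relabel-inverse : ∀ V x → lookup (relabel π V) (π ⟨$⟩ˡ x) ≡ lookup V x
  lookup-relabel-inverse V x = trans (lookup-relabel π V _) (cong (lookup V) (inverseʳ π))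

  relabel-agree : ∀ k → lookup S (π ⟨$⟩ʳ k) ≡ lookup U (π ⟨$⟩ʳ k) →
    lookup (relabel π S) k ≡ lookup (relabel π U) k
  relabel-agree k e = trans (lookup-relabel π S k) (trans e (sym (lookup-relabel π U k)))

  relabel-agree⁻¹ : ∀ x → lookup (relabel π S) (π ⟨$⟩ˡ x) ≡ lookup (relabel π U) (π ⟨$⟩ˡ x) →
    lookup S x ≡ lookup U x
  relabel-agree⁻¹ x e = trans (sym (lookup-relabel-inverse S x)) (trans e (lookup-relabel-inverse U x))

_≺⟨_⟩_ : Fin n → Permutation′ n → Fin n → Set
x ≺⟨ ρ ⟩ y = ρ ⟨$⟩ˡ x < ρ ⟨$⟩ˡ y

T-<[]⇔≺ : (ρ : Permutation′ n) (x y : Fin n) → T (x <[ ρ ] y) ⇔ x ≺⟨ ρ ⟩ y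
T-<[]⇔≺ ρ x y = mk⇔ (ℕ.<ᵇ⇒< _ _) ℕ.<⇒<ᵇ

IsMaxσ : Permutation′ n → List (Fin n) → Maybe (Fin n) → Set
IsMaxσ ρ xs nothing  = xs ≡ []
IsMaxσ ρ xs (just m) = m ∈ xs × (∀ {y} → y ∈ xs → ¬ m ≺⟨ ρ ⟩ y)

maxσ-isMax : (ρ : Permutation′ n) (xs : List (Fin n)) → IsMaxσ ρ xs (maxσ ρ xs)
maxσ-isMax ρ [] = refl
maxσ-isMax ρ (x ∷ xs) with maxσ ρ xs | maxσ-isMax ρ xs
... | nothing | refl = here refl , λ { (here refl) → <-irrefl refl }
... | just y  | y∈xs , y-max with x <[ ρ ] y in x<y
...   | true  = there y∈xs , λ { (here refl) y≺x → <-asym y≺x (Equivalence.to (T-<[]⇔≺ ρ x y) (Equivalence.from T-≡ x<y))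
                               ; (there z∈xs) → y-max z∈xs }
...   | false = here refl , λ { (here refl) → <-irrefl refl
                              ; (there z∈xs) x≺z → y-max z∈xs (ℕ.≤-<-trans y≤x x≺z) }
  where
  y≤x : toℕ (ρ ⟨$⟩ˡ y) ≤ toℕ (ρ ⟨$⟩ˡ x)
  y≤x = ℕ.≮⇒≥ (λ x≺y → subst T x<y (Equivalence.from (T-<[]⇔≺ ρ x y) x≺y))

∈ᵇ-lookup : (x : Fin n) (S : Subset n) → (x ∈ᵇ S) ≡ lookup S x
∈ᵇ-lookup x S with lookup S x
... | true  = refl
... | false = refl

T-xor : (a b : Bool) → T (a xor b) ⇔ a ≢ b
T-xor false false = mk⇔ (λ ()) (λ a≢b → a≢b refl)
T-xor false true  = mk⇔ (λ _ ()) _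
T-xor true  false = mk⇔ (λ _ ()) _
T-xor true  true  = mk⇔ (λ ()) (λ a≢b → a≢b refl)

∈-symDiff : (S U : Subset n) (x : Fin n) → x ∈ symDiff S U ⇔ lookup S x ≢ lookup U x
∈-symDiff S U x = mk⇔
  (λ x∈ → Equivalence.to xor⇔≢ (proj₂ (∈-filter⁻ differs? {xs = allFin _} x∈)))
  (λ Sx≢Ux → ∈-filter⁺ differs? (∈-allFin x) (Equivalence.from xor⇔≢ Sx≢Ux))
  where
  differs? = λ (i : Fin _) → T? ((i ∈ᵇ S) xor (i ∈ᵇ U))
  xor⇔≢ : T ((x ∈ᵇ S) xor (x ∈ᵇ U)) ⇔ lookup S x ≢ lookup U x
  xor⇔≢ rewrite ∈ᵇ-lookup x S | ∈ᵇ-lookup x U = T-xor _ _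

Lt⇒RevlexLt : (ρ : Permutation′ n) (S U : Subset n) → Lt ρ S U ≡ true → RevlexLt _≺⟨ ρ ⟩_ S U
Lt⇒RevlexLt ρ S U with maxσ ρ (symDiff S U) | maxσ-isMax ρ (symDiff S U)
... | nothing | _ = λ ()
... | just x  | x∈ , x-max = λ Ux → x , (Equivalence.to (∈-symDiff S U x) x∈ , agree) , trans (sym (∈ᵇ-lookup x U)) Ux
  where
  agree : ∀ y → x ≺⟨ ρ ⟩ y → lookup S y ≡ lookup U y
  agree y x≺y with lookup S y ≟ᵇ lookup U y
  ... | yes Sy≡Uy = Sy≡Uy
  ... | no Sy≢Uy  = ⊥-elim (x-max (Equivalence.from (∈-symDiff S U y) Sy≢Uy) x≺y)

RevlexLt⇒Lt : (ρ : Permutation′ n) (S U : Subset n) → RevlexLt _≺⟨ ρ ⟩_ S U → Lt ρ S U ≡ true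
RevlexLt⇒Lt ρ S U (x , (Sx≢Ux , agree) , Ux)
  with maxσ ρ (symDiff S U) | maxσ-isMax ρ (symDiff S U) | Equivalence.from (∈-symDiff S U x) Sx≢Ux
... | nothing | symDiff≡[] | x∈ with () ← subst (x ∈_) symDiff≡[] x∈
... | just m  | m∈ , m-max | x∈ with <-cmp (ρ ⟨$⟩ˡ m) (ρ ⟨$⟩ˡ x)
...   | tri< m≺x _ _ = ⊥-elim (m-max x∈ m≺x)
...   | tri> _ _ x≺m = ⊥-elim (Equivalence.to (∈-symDiff S U m) m∈ (agree m x≺m))
...   | tri≈ _ ρ⁻¹m≡ρ⁻¹x _ = trans (∈ᵇ-lookup m U) (subst (λ y → lookup U y ≡ true) (sym m≡x) Ux)
  where
  m≡x : m ≡ x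
  m≡x = trans (sym (inverseʳ ρ)) (trans (cong (ρ ⟨$⟩ʳ_) ρ⁻¹m≡ρ⁻¹x) (inverseʳ ρ))

differ : Subset n → Subset n → Bool
differ []      []      = false
differ (x ∷ u) (y ∷ v) = (x xor y) ∨ differ u v

differ-false : (u v : Subset n) → differ u v ≡ false → ∀ i → lookup u i ≡ lookup v i
differ-false (true  ∷ u) (true  ∷ v) d zero    = refl
differ-false (false ∷ u) (false ∷ v) d zero    = refl
differ-false (true  ∷ u) (true  ∷ v) d (suc i) = differ-false u v d i
differ-false (false ∷ u) (false ∷ v) d (suc i) = differ-false u v d i

differ-true : (u v : Subset n) → differ u v ≡ true → ∃ λ i → lookup u i ≢ lookup v i
differ-true []          []          ()
differ-true (true  ∷ u) (false ∷ v) _ = zero , λ ()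
differ-true (false ∷ u) (true  ∷ v) _ = zero , λ ()
differ-true (true  ∷ u) (true  ∷ v) d with differ-true u v d
... | i , ui≢vi = suc i , ui≢vi
differ-true (false ∷ u) (false ∷ v) d with differ-true u v d
... | i , ui≢vi = suc i , ui≢vi

_<colex_ : Subset n → Subset n → Bool
[]      <colex []      = false
(x ∷ u) <colex (y ∷ v) = if differ u v then u <colex v else not x ∧ y

_<lex_ : Subset n → Subset n → Bool
[]      <lex []      = false
(x ∷ u) <lex (y ∷ v) = if x xor y then y else u <lex v

colex⇒RevlexLt : (u v : Subset n) → u <colex v ≡ true → RevlexLt _<_ u v
colex⇒RevlexLt []      []      ()
colex⇒RevlexLt (x ∷ u) (y ∷ v) u<v with differ u v in d
... | true with colex⇒RevlexLt u v u<v
...   | k , (uk≢vk , agree) , vk = suc k , (uk≢vk , λ { zero () ; (suc j) (s<s k<j) → agree j k<j }) , vk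
colex⇒RevlexLt (false ∷ u) (true ∷ v) _ | false =
  zero , ((λ ()) , λ { zero () ; (suc j) _ → differ-false u v d j }) , refl

RevlexLt⇒colex : (u v : Subset n) → RevlexLt _<_ u v → u <colex v ≡ true
RevlexLt⇒colex (x ∷ u) (y ∷ v) (k , (uk≢vk , agree) , vk) with differ u v in d | k
... | true  | zero with i , ui≢vi ← differ-true u v d = ⊥-elim (ui≢vi (agree (suc i) z<s))
... | true  | suc k = RevlexLt⇒colex u v (k , (uk≢vk , λ j k<j → agree (suc j) (s<s k<j)) , vk)
... | false | suc k = ⊥-elim (uk≢vk (differ-false u v d k))
RevlexLt⇒colex (false ∷ u) (true  ∷ v) _ | false | zero = refl
RevlexLt⇒colex (true  ∷ u) (true  ∷ v) (_ , (x≢y , _) , _) | false | zero = ⊥-elim (x≢y refl)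

RevlexLt->-∷⁻ : {b : Bool} {u v : Subset n} → RevlexLt _>_ (b ∷ u) (b ∷ v) → RevlexLt _>_ u v
RevlexLt->-∷⁻ (zero  , (b≢b , _) , _)     = ⊥-elim (b≢b refl)
RevlexLt->-∷⁻ (suc k , (uk≢vk , agree) , vk) = k , (uk≢vk , λ j j<k → agree (suc j) (s<s j<k)) , vk

RevlexLt->-∷⁺ : {b : Bool} {u v : Subset n} → RevlexLt _>_ u v → RevlexLt _>_ (b ∷ u) (b ∷ v)
RevlexLt->-∷⁺ (k , (uk≢vk , agree) , vk) =
  suc k , (uk≢vk , λ { zero _ → refl ; (suc j) (s<s j<k) → agree j j<k }) , vk

lex⇒RevlexLt : (u v : Subset n) → u <lex v ≡ true → RevlexLt _>_ u v
lex⇒RevlexLt []          []          ()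
lex⇒RevlexLt (false ∷ u) (true  ∷ v) _   = zero , ((λ ()) , λ _ ()) , refl
lex⇒RevlexLt (true  ∷ u) (true  ∷ v) u<v = RevlexLt->-∷⁺ (lex⇒RevlexLt u v u<v)
lex⇒RevlexLt (false ∷ u) (false ∷ v) u<v = RevlexLt->-∷⁺ (lex⇒RevlexLt u v u<v)

RevlexLt⇒lex : (u v : Subset n) → RevlexLt _>_ u v → u <lex v ≡ true
RevlexLt⇒lex (false ∷ u) (true  ∷ v) _ = refl
RevlexLt⇒lex (true  ∷ u) (true  ∷ v) r = RevlexLt⇒lex u v (RevlexLt->-∷⁻ r)
RevlexLt⇒lex (false ∷ u) (false ∷ v) r = RevlexLt⇒lex u v (RevlexLt->-∷⁻ r)
RevlexLt⇒lex (true  ∷ u) (false ∷ v) (zero  , _ , ())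
RevlexLt⇒lex (true  ∷ u) (false ∷ v) (suc k , (_ , agree) , _) with () ← agree zero z<s

Lt⇔RevlexLt : (ρ : Permutation′ n) (S U : Subset n) → Lt ρ S U ≡ true ⇔ RevlexLt _≺⟨ ρ ⟩_ S U
Lt⇔RevlexLt ρ S U = mk⇔ (Lt⇒RevlexLt ρ S U) (RevlexLt⇒Lt ρ S U)

colex⇔RevlexLt : (u v : Subset n) → u <colex v ≡ true ⇔ RevlexLt _<_ u v
colex⇔RevlexLt u v = mk⇔ (colex⇒RevlexLt u v) (RevlexLt⇒colex u v)

lex⇔RevlexLt : (u v : Subset n) → u <lex v ≡ true ⇔ RevlexLt _>_ u v
lex⇔RevlexLt u v = mk⇔ (lex⇒RevlexLt u v) (RevlexLt⇒lex u v)

opposite-< : {i j : Fin n} → i < j → opposite j < opposite i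
opposite-< {i = i} {j} i<j =
  subst₂ _<ℕ_ (sym (opposite-prop j)) (sym (opposite-prop i)) (ℕ.∸-monoʳ-< (s<s i<j) (toℕ<n j))

opposite-<⇔> : {i j : Fin n} → opposite i < opposite j ⇔ i > j
opposite-<⇔> {i = i} {j} = mk⇔
  (λ oi<oj → subst₂ _<_ (opposite-involutive j) (opposite-involutive i) (opposite-< oi<oj))
  opposite-<

Lt≡colex : (σ : Permutation′ n) (S U : Subset n) → Lt σ S U ≡ relabel σ S <colex relabel σ U
Lt≡colex σ S U = ⇔→≡ (⇔.trans (Lt⇔RevlexLt σ S U)
                     (⇔.trans (⇔.sym (RevlexLt-relabel σ _<_ {S} {U}))
                              (⇔.sym (colex⇔RevlexLt (relabel σ S) (relabel σ U)))))

Lt-rev≡lex : (σ : Permutation′ n) (S U : Subset n) → Lt (rev σ) U S ≡ relabel σ U <lex relabel σ S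
Lt-rev≡lex σ S U = ⇔→≡ (⇔.trans (Lt⇔RevlexLt (rev σ) U S)
                       (⇔.trans (RevlexLt-cong (λ _ _ → opposite-<⇔>) {U} {S})
                       (⇔.trans (⇔.sym (RevlexLt-relabel σ _>_ {U} {S}))
                                (⇔.sym (lex⇔RevlexLt (relabel σ U) (relabel σ S))))))

distance-rev≡#pairs-colex-lex : (σ : Permutation′ n) →
  distance σ (rev σ) ≡ #pairs {n} (λ u v → u <colex v ∧ v <lex u)
distance-rev≡#pairs-colex-lex {n} σ = begin
  distance σ (rev σ)
    ≡⟨ distance≡#pairs σ (rev σ) ⟩
  #pairs (λ S U → Lt σ S U ∧ Lt (rev σ) U S)
    ≡⟨ #pairs-cong (λ S U → cong₂ _∧_ (Lt≡colex σ S U) (Lt-rev≡lex σ S U)) ⟩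
  #pairs (λ S U → relabel σ S <colex relabel σ U ∧ relabel σ U <lex relabel σ S)
    ≡⟨ #pairs-relabel σ (λ u v → u <colex v ∧ v <lex u) ⟩
  #pairs {n} (λ u v → u <colex v ∧ v <lex u) ∎
  where open ≡-Reasoning

colex-equal : (u v : Subset n) → differ u v ≡ false → u <colex v ≡ false
colex-equal u v d with u <colex v in u<v
... | false = refl
... | true with k , (uk≢vk , _) , _ ← colex⇒RevlexLt u v u<v = ⊥-elim (uk≢vk (differ-false u v d k))

colex-if-differ : (u v : Subset n) → (if differ u v then u <colex v else false) ≡ u <colex v
colex-if-differ u v with differ u v in d
... | true  = refl
... | false = sym (colex-equal u v d)

indicator-colex-or-equal : (u v : Subset n) →
  indicator (if differ u v then u <colex v else true) ≡ indicator (u <colex v) + indicator (not (differ u v))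
indicator-colex-or-equal u v with differ u v in d
... | true  = sym (ℕ.+-identityʳ _)
... | false rewrite colex-equal u v d = refl

#pairs-equal : ∀ n → #pairs {n} (λ u v → not (differ u v)) ≡ 2 ^ n
#pairs-equal zero    = refl
#pairs-equal (suc n) = trans (#pairs-suc {n} (λ u v → not (differ u v)))
  (trans (cong₂ (λ e f → (e + f) + (f + e)) (#pairs-equal n) (#pairs-false {n})) (double (2 ^ n)))
  where
  double : ∀ p → (p + 0) + (0 + p) ≡ 2 * p
  double = solve-∀

#pairs-colex-suc : ∀ n → let C = #pairs {n} _<colex_; E = #pairs {n} (λ u v → not (differ u v)) in
  #pairs {suc n} _<colex_ ≡ (C + C) + ((C + E) + C)
#pairs-colex-suc n = trans (#pairs-suc {n} _<colex_) (cong₂ _+_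
  (cong₂ _+_ (#pairs-cong {n} colex-if-differ) (#pairs-cong {n} colex-if-differ))
  (cong₂ _+_ (#pairs-split {n} {Q = _<colex_} {R = λ u v → not (differ u v)} indicator-colex-or-equal)
             (#pairs-cong {n} colex-if-differ)))

#pairs-colex : ∀ n → 2 * #pairs {n} _<colex_ + 2 ^ n ≡ 4 ^ n
#pairs-colex zero    = refl
#pairs-colex (suc n) = begin
  2 * #pairs {suc n} _<colex_ + 2 ^ suc n
    ≡⟨ cong₂ (λ c p → 2 * c + 2 * p) (#pairs-colex-suc n) (sym (#pairs-equal n)) ⟩
  2 * ((C + C) + ((C + E) + C)) + 2 * E
    ≡⟨ recurrence C E ⟩
  4 * (2 * C + E)
    ≡⟨ cong (λ e → 4 * (2 * C + e)) (#pairs-equal n) ⟩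
  4 * (2 * C + 2 ^ n)
    ≡⟨ cong (4 *_) (#pairs-colex n) ⟩
  4 ^ suc n ∎
  where
  open ≡-Reasoning
  C = #pairs {n} _<colex_
  E = #pairs {n} (λ u v → not (differ u v))
  recurrence : ∀ c p → 2 * ((c + c) + ((c + p) + c)) + 2 * p ≡ 4 * (2 * c + p)
  recurrence = solve-∀

#pairs-colex-lex-suc : ∀ n → let W = #pairs {n} (λ u v → u <colex v ∧ v <lex u); C = #pairs {n} _<colex_ in
  #pairs {suc n} (λ u v → u <colex v ∧ v <lex u) ≡ (W + C) + (0 + W)
#pairs-colex-lex-suc n = trans (#pairs-suc {n} (λ u v → u <colex v ∧ v <lex u)) (cong₂ _+_
  (cong₂ _+_ (#pairs-cong {n} λ u v → cong (_∧ v <lex u) (colex-if-differ u v))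
             (#pairs-cong {n} λ u v → trans (∧-identityʳ _) (colex-if-differ u v)))
  (cong₂ _+_ (trans (#pairs-cong {n} λ u v → ∧-zeroʳ ((false ∷ u) <colex (true ∷ v))) (#pairs-false {n}))
             (#pairs-cong {n} λ u v → cong (_∧ v <lex u) (colex-if-differ u v))))

#pairs-colex-lex : ∀ n → 4 * #pairs {n} (λ u v → u <colex v ∧ v <lex u) + (n + 1) * 2 ^ n ≡ 4 ^ n
#pairs-colex-lex zero    = refl
#pairs-colex-lex (suc n) = begin
  4 * #pairs {suc n} (λ u v → u <colex v ∧ v <lex u) + (suc n + 1) * 2 ^ suc n
    ≡⟨ cong (λ w → 4 * w + (suc n + 1) * 2 ^ suc n) (#pairs-colex-lex-suc n) ⟩
  4 * ((W + C) + (0 + W)) + (suc n + 1) * (2 * 2 ^ n)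
    ≡⟨ recurrence W C n (2 ^ n) ⟩
  2 * (4 * W + (n + 1) * 2 ^ n) + 2 * (2 * C + 2 ^ n)
    ≡⟨ cong₂ (λ a b → 2 * a + 2 * b) (#pairs-colex-lex n) (#pairs-colex n) ⟩
  2 * 4 ^ n + 2 * 4 ^ n
    ≡⟨ halves (4 ^ n) ⟩
  4 ^ suc n ∎
  where
  open ≡-Reasoning
  W = #pairs {n} (λ u v → u <colex v ∧ v <lex u)
  C = #pairs {n} _<colex_
  recurrence : ∀ w c m p → 4 * ((w + c) + (0 + w)) + (suc m + 1) * (2 * p)
                         ≡ 2 * (4 * w + (m + 1) * p) + 2 * (2 * c + p)
  recurrence = solve-∀
  halves : ∀ q → 2 * q + 2 * q ≡ 4 * q
  halves = solve-∀

proposition1 : (n : ℕ) → 1 ≤ n → (σ : Permutation′ n) →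
    4 * distance σ (rev σ) + (n + 1) * 2 ^ n ≡ 2 ^ (2 * n)
proposition1 n _ σ = begin
  4 * distance σ (rev σ) + (n + 1) * 2 ^ n
    ≡⟨ cong (λ d → 4 * d + (n + 1) * 2 ^ n) (distance-rev≡#pairs-colex-lex σ) ⟩
  4 * #pairs {n} (λ u v → u <colex v ∧ v <lex u) + (n + 1) * 2 ^ n
    ≡⟨ #pairs-colex-lex n ⟩
  4 ^ n
    ≡⟨ ℕ.^-*-assoc 2 2 n ⟩
  2 ^ (2 * n) ∎
  where open ≡-Reasoning
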